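{- Let $G$ be a graph, let $j\ge 1$, and let $S$ be a set of pairwise edge-disjoint geodesics of $G$, each of length $j$. Let $\ell=\min\{d_G(P,Q): P,Q\in S,\ P\neq Q\}$. Let $k\ge 2$ be an integer, and suppose that $d_G(P,Q)<\ell(k-1)+j(k-2)$ holds for every two distinct $P,Q\in S$ that both lie on a common geodesic of $G$. Then no $k$ paths from $S$ lie on a common geodesic of $G$.
   Context: A geodesic is a shortest path; its length is its number of edges. For subgraphs $H,H'$ of $G$, $d_G(H,H')=\min\{d_G(x,y): x\in V(H), y\in V(H')\}$. A path $P$ lies on a geodesic $R$ if $P$ is a subpath of $R$. -}

module Defs where

open import Data.Nat using (ℕ; suc; _∸_; _≤_)
open import Data.List using (List; []; _∷_; _++_; length; head; last; reverse)
open import Data.List.Membership.Propositional using (_∈_)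
open import Data.List.Relation.Unary.Unique.Propositional using (Unique)
open import Data.Maybe using (just)
open import Data.Product using (Σ; _×_; ∃; ∃-syntax)
open import Data.Sum using (_⊎_)
open import Data.Empty using (⊥)
open import Data.Unit using (⊤)
open import Relation.Binary.PropositionalEquality using (_≡_)
open import Relation.Nullary using (¬_)

record Graph : Set₁ where
  field
    V     : Set
    E     : V → V → Set
    sym   : ∀ {x y} → E x y → E y x
    irrefl : ∀ {x} → ¬ E x x

module _ (G : Graph) where
  open Graph G

  IsWalk : List V → Set
  IsWalk []           = ⊥
  IsWalk (x ∷ [])     = ⊤
  IsWalk (x ∷ y ∷ xs) = E x y × IsWalk (y ∷ xs)

  IsPath : List V → Set
  IsPath p = IsWalk p × Unique p

  len : List V → ℕ
  len w = length w ∸ 1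

  WalkFromTo : V → V → List V → Set
  WalkFromTo x y w = IsWalk w × head w ≡ just x × last w ≡ just y

  IsGeodesic : List V → Set
  IsGeodesic R = IsPath R ×
    (∀ x y w → head R ≡ just x → last R ≡ just y → WalkFromTo x y w → len R ≤ len w)

  SetDist : List V → List V → ℕ → Set
  SetDist P Q d =
    (∃[ x ] ∃[ y ] ∃[ w ] (x ∈ P × y ∈ Q × WalkFromTo x y w × len w ≡ d)) ×
    (∀ x y w → x ∈ P → y ∈ Q → WalkFromTo x y w → d ≤ len w)

  data Consec (u v : V) : List V → Set where
    here  : ∀ {xs} → Consec u v (u ∷ v ∷ xs)
    there : ∀ {x xs} → Consec u v xs → Consec u v (x ∷ xs)

  HasEdge : V → V → List V → Set
  HasEdge u v P = Consec u v P ⊎ Consec v u P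

  EdgeDisjoint : List V → List V → Set
  EdgeDisjoint P Q = ∀ u v → HasEdge u v P → HasEdge u v Q → ⊥

  LiesOn : List V → List V → Set
  LiesOn P R = (∃[ as ] ∃[ bs ] R ≡ as ++ P ++ bs)
             ⊎ (∃[ as ] ∃[ bs ] R ≡ as ++ reverse P ++ bs)

  OnCommonGeodesic : List V → List V → Set
  OnCommonGeodesic P Q = ∃[ R ] (IsGeodesic R × LiesOn P R × LiesOn Q R)

  IsMinSetDist : (List V → Set) → ℕ → Set
  IsMinSetDist S ℓ =
    (∃[ P ] ∃[ Q ] (S P × S Q × ¬ P ≡ Q × SetDist P Q ℓ)) ×
    (∀ P Q d → S P → S Q → ¬ P ≡ Q → SetDist P Q d → ℓ ≤ d)

-- Number the vertices of the geodesic R as r 0, …, r N.  A geodesic of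
-- length j lying on R occupies a stretch r a, …, r (a + j), and the
-- distance between two such stretches at a + j ≤ b is exactly b ∸ (a + j),
-- since R is itself a geodesic.  Edge-disjointness forces a + j ≤ b, and the
-- minimality of ℓ then gives a + (ℓ + j) ≤ b.  So k paths of S on R start at
-- pairwise (ℓ + j)-separated positions; the first and the last are at least
-- (k − 1)(ℓ + j) apart, and their distance is at least
-- (k − 1)(ℓ + j) − j = ℓ (k − 1) + j (k − 2), contradicting the hypothesis.
module Submission where

open import Defs
open import Data.Nat using (ℕ; zero; suc; _∸_; _+_; _*_; _≤_; _<_; z≤n; s≤s; s≤s⁻¹; _≤?_)
open import Data.Nat.Properties
open import Data.Nat.Solver using (module +-*-Solver)
open import Data.Fin as Fin using (Fin; punchIn)
open import Data.Fin.Properties using (punchIn-injective; punchInᵢ≢i)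
open import Data.List using (List; []; _∷_; _++_; length; last; reverse; allFin)
open import Data.List.Properties using (length-++; length-reverse; unfold-reverse; reverse-involutive; ++-assoc)
open import Data.List.Extrema.Nat using (argmax; f[xs]≤f[argmax])
open import Data.List.Membership.Propositional using (_∈_)
open import Data.List.Membership.Propositional.Properties using (∈-allFin)
import Data.List.Relation.Unary.All as All
open import Data.List.Relation.Unary.Any using (here; there)
open import Data.List.Relation.Unary.Any.Properties using (reverse⁺; reverse⁻)
open import Data.Maybe using (just)
open import Data.Product using (_×_; _,_; proj₁; proj₂; ∃-syntax)
open import Data.Sum using (_⊎_; inj₁; inj₂)
open import Data.Empty using (⊥; ⊥-elim)
open import Data.Unit using (tt)
open import Relation.Binary.PropositionalEquality
open import Relation.Nullary using (¬_; yes; no)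
open import Function using (_∘_)
open import Function.Definitions using (Injective)

Separated : ∀ {n} → ℕ → (Fin n → ℕ) → Set
Separated c f = ∀ {i i'} → i ≢ i' → f i ≤ f i' → f i + c ≤ f i'

-- Opaque: with-abstracting over an unfolded argmax makes type checking blow up.
opaque
  maximum-at : ∀ {n} (f : Fin (suc n) → ℕ) → ∃[ m ] (∀ t → f t ≤ f m)
  maximum-at f = argmax f Fin.zero (allFin _) ,
    λ t → All.lookup (f[xs]≤f[argmax] {f = f} Fin.zero (allFin _)) (∈-allFin t)

module _ {c : ℕ} where

  separated⇒spread : ∀ n (f : Fin (suc n) → ℕ) → Separated c f →
    ∃[ i ] ∃[ i' ] (f i + n * c ≤ f i')
  separated⇒spread-≢ : ∀ n (f : Fin (suc (suc n)) → ℕ) → Separated c f →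
    ∃[ i ] ∃[ i' ] (i ≢ i' × f i + suc n * c ≤ f i')

  separated⇒spread zero    f _   = Fin.zero , Fin.zero , ≤-reflexive (+-identityʳ _)
  separated⇒spread (suc n) f sep with separated⇒spread-≢ n f sep
  ... | i , i' , _ , spread = i , i' , spread

  -- Remove a maximum and recurse: the maximum lies at least c above every other value.
  separated⇒spread-≢ n f sep with maximum-at f
  ... | m , f≤fm with separated⇒spread n (f ∘ punchIn m) (λ i≢i' → sep (i≢i' ∘ punchIn-injective m _ _))
  ... | i , i' , spread = punchIn m i , m , punchInᵢ≢i m i , (begin
    f (punchIn m i) + (c + n * c)  ≡⟨ cong (f (punchIn m i) +_) (+-comm c (n * c)) ⟩
    f (punchIn m i) + (n * c + c)  ≡⟨ +-assoc (f (punchIn m i)) (n * c) c ⟨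
    f (punchIn m i) + n * c + c    ≤⟨ +-monoˡ-≤ c spread ⟩
    f (punchIn m i') + c           ≤⟨ sep (punchInᵢ≢i m i') (f≤fm _) ⟩
    f m                            ∎)
    where open ≤-Reasoning

spread⇒gap : ∀ a b j ℓ m → a + suc m * (ℓ + j) ≤ b → ℓ * suc m + j * m ≤ b ∸ (a + j)
spread⇒gap a b j ℓ m le = begin
  ℓ * suc m + j * m                        ≡⟨ m+n∸m≡n (a + j) _ ⟨
  a + j + (ℓ * suc m + j * m) ∸ (a + j)    ≡⟨ cong (_∸ (a + j)) (expand a j ℓ m) ⟩
  a + suc m * (ℓ + j) ∸ (a + j)            ≤⟨ ∸-monoˡ-≤ (a + j) le ⟩
  b ∸ (a + j)                              ∎
  where
  open ≤-Reasoning
  open +-*-Solver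
  expand : ∀ a j ℓ m → a + j + (ℓ * suc m + j * m) ≡ a + suc m * (ℓ + j)
  expand = solve 4 (λ a j ℓ m → a :+ j :+ (ℓ :* (con 1 :+ m) :+ j :* m)
                              := a :+ (con 1 :+ m) :* (ℓ :+ j)) refl

module _ {A : Set} (d : A) where

  nth : List A → ℕ → A
  nth []       _       = d
  nth (x ∷ xs) zero    = x
  nth (x ∷ xs) (suc i) = nth xs i

  nth-++ʳ : ∀ xs ys i → nth (xs ++ ys) (length xs + i) ≡ nth ys i
  nth-++ʳ []       ys i = refl
  nth-++ʳ (x ∷ xs) ys i = nth-++ʳ xs ys i

  nth-++ˡ : ∀ xs ys {i} → i < length xs → nth (xs ++ ys) i ≡ nth xs i
  nth-++ˡ (x ∷ xs) ys {zero}  _         = refl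
  nth-++ˡ (x ∷ xs) ys {suc i} (s≤s lt) = nth-++ˡ xs ys lt

  nth-∈ : ∀ xs {i} → i < length xs → nth xs i ∈ xs
  nth-∈ (x ∷ xs) {zero}  _        = here refl
  nth-∈ (x ∷ xs) {suc i} (s≤s lt) = there (nth-∈ xs lt)

  ∈⇒nth : ∀ {xs y} → y ∈ xs → ∃[ i ] (i < length xs × y ≡ nth xs i)
  ∈⇒nth (here eq) = zero , s≤s z≤n , eq
  ∈⇒nth (there m) with ∈⇒nth m
  ... | i , lt , eq = suc i , s≤s lt , eq

  last≡nth : ∀ x xs → last (x ∷ xs) ≡ just (nth (x ∷ xs) (length xs))
  last≡nth x []       = refl
  last≡nth x (y ∷ ys) = last≡nth y ys

module _ (G : Graph) where
  open Graph G using (V; E)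

  consec-++ʳ : ∀ {u v} xs {ys} → Consec G u v ys → Consec G u v (xs ++ ys)
  consec-++ʳ []       c = c
  consec-++ʳ (x ∷ xs) c = there (consec-++ʳ xs c)

  consec-++ˡ : ∀ {u v xs} ys → Consec G u v xs → Consec G u v (xs ++ ys)
  consec-++ˡ ys here      = here
  consec-++ˡ ys (there c) = there (consec-++ˡ ys c)

  consec-reverse : ∀ {u v} xs → Consec G u v xs → Consec G v u (reverse xs)
  consec-reverse {u} {v} (u ∷ v ∷ ys) here =
    subst (Consec G v u) (sym unfold) (consec-++ʳ (reverse ys) here)
    where
    unfold : reverse (u ∷ v ∷ ys) ≡ reverse ys ++ v ∷ u ∷ []
    unfold = begin
      reverse (u ∷ v ∷ ys)              ≡⟨ unfold-reverse u (v ∷ ys) ⟩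
      reverse (v ∷ ys) ++ u ∷ []        ≡⟨ cong (_++ u ∷ []) (unfold-reverse v ys) ⟩
      (reverse ys ++ v ∷ []) ++ u ∷ []  ≡⟨ ++-assoc (reverse ys) (v ∷ []) (u ∷ []) ⟩
      reverse ys ++ v ∷ u ∷ []          ∎
      where open ≡-Reasoning
  consec-reverse (x ∷ ys) (there c) =
    subst (Consec G _ _) (sym (unfold-reverse x ys)) (consec-++ˡ (x ∷ []) (consec-reverse ys c))

  hasEdge-reverse⁻ : ∀ {u v} P → HasEdge G u v (reverse P) → HasEdge G u v P
  hasEdge-reverse⁻ P (inj₁ c) = inj₂ (subst (Consec G _ _) (reverse-involutive P) (consec-reverse _ c))
  hasEdge-reverse⁻ P (inj₂ c) = inj₁ (subst (Consec G _ _) (reverse-involutive P) (consec-reverse _ c))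

  nth-consec : ∀ d xs {i} → suc i < length xs → Consec G (nth d xs i) (nth d xs (suc i)) xs
  nth-consec d (x ∷ y ∷ xs) {zero}  _        = here
  nth-consec d (x ∷ y ∷ xs) {suc i} (s≤s lt) = there (nth-consec d (y ∷ xs) lt)
  nth-consec d (x ∷ [])              (s≤s ())

  nth-edge : ∀ d xs {i} → IsWalk G xs → suc i < length xs → E (nth d xs i) (nth d xs (suc i))
  nth-edge d (x ∷ y ∷ xs) {zero}  (e , _)  _        = e
  nth-edge d (x ∷ y ∷ xs) {suc i} (_ , wk) (s≤s lt) = nth-edge d (y ∷ xs) wk lt
  nth-edge d (x ∷ [])              _        (s≤s ())

  length≡suc-len : ∀ w → IsWalk G w → length w ≡ suc (len G w)
  length≡suc-len (x ∷ w) _ = refl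

  walkFromTo-∷ : ∀ {a b z w} → E a b → WalkFromTo G b z w →
    WalkFromTo G a z (a ∷ w) × len G (a ∷ w) ≡ suc (len G w)
  walkFromTo-∷ {w = c ∷ w} e (wk , refl , l) = ((e , wk) , refl , l) , refl

  walkFromTo-++ : ∀ {x y z w w'} → WalkFromTo G x y w → WalkFromTo G y z w' →
    ∃[ w'' ] (WalkFromTo G x z w'' × len G w'' ≡ len G w + len G w')
  walkFromTo-++ {w = a ∷ []}         (_ , refl , refl) W' = _ , W' , refl
  walkFromTo-++ {w = a ∷ b ∷ rest} ((e , wk) , refl , l) W' with walkFromTo-++ (wk , refl , l) W'
  ... | w'' , W'' , len≡ with walkFromTo-∷ e W''
  ... | W , len-∷ = a ∷ w'' , W , trans len-∷ (cong suc len≡)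

  segment : (ℕ → V) → ℕ → List V
  segment r zero    = r 0 ∷ []
  segment r (suc m) = r 0 ∷ segment (r ∘ suc) m

  segment-walk : ∀ r m → (∀ {i} → i < m → E (r i) (r (suc i))) →
    WalkFromTo G (r 0) (r m) (segment r m) × len G (segment r m) ≡ m
  segment-walk r zero    _    = (tt , refl , refl) , refl
  segment-walk r (suc m) edge with segment-walk (r ∘ suc) m (edge ∘ s≤s)
  ... | W , len≡ with walkFromTo-∷ (edge (s≤s z≤n)) W
  ... | W′ , len-∷ = W′ , trans len-∷ (cong suc len≡)

  module OnGeodesic (x₀ : V) (R' : List V) (geoR : IsGeodesic G (x₀ ∷ R')) (j : ℕ) where
    R : List V
    R = x₀ ∷ R'

    N : ℕ
    N = length R'

    r : ℕ → V
    r = nth x₀ R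

    r-edge : ∀ {i} → i < N → E (r i) (r (suc i))
    r-edge lt = nth-edge x₀ R (proj₁ (proj₁ geoR)) (s≤s lt)

    stretch : ∀ p m → m + p ≤ N →
      WalkFromTo G (r p) (r (m + p)) (segment (λ i → r (i + p)) m) ×
      len G (segment (λ i → r (i + p)) m) ≡ m
    stretch p m le = segment-walk (λ i → r (i + p)) m (λ lt → r-edge (≤-trans (+-monoˡ-< p lt) le))

    -- Prolong the walk by the two end stretches of R and compare with R.
    walk-length-on-geodesic : ∀ {p q w} → p ≤ q → q ≤ N → WalkFromTo G (r p) (r q) w → q ∸ p ≤ len G w
    walk-length-on-geodesic {p} {q} {w} p≤q q≤N W
      with segment-walk r p (λ lt → r-edge (≤-trans lt (≤-trans p≤q q≤N)))
         | stretch q (N ∸ q) (≤-reflexive (m∸n+n≡m q≤N))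
    ... | W₁ , len₁ | W₂ , len₂ with walkFromTo-++ W₁ W
    ... | w₃ , W₃ , len₃ with walkFromTo-++ W₃ W₂
    ... | w₄ , W₄ , len₄ = m≤n+o⇒m∸n≤o q p (begin
      q                                ≡⟨ m∸[m∸n]≡n q≤N ⟨
      N ∸ (N ∸ q)                      ≤⟨ ∸-monoˡ-≤ (N ∸ q) N≤len ⟩
      len G w₄ ∸ (N ∸ q)               ≡⟨ cong (_∸ (N ∸ q)) len-through-w ⟩
      p + len G w + (N ∸ q) ∸ (N ∸ q)  ≡⟨ m+n∸n≡m (p + len G w) (N ∸ q) ⟩
      p + len G w                      ∎)
      where
      open ≤-Reasoning
      N≤len : N ≤ len G w₄
      N≤len = proj₂ geoR (r 0) (r N) w₄ refl (last≡nth x₀ x₀ R')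
        (subst (λ t → WalkFromTo G (r 0) (r t) w₄) (m∸n+n≡m q≤N) W₄)
      len-through-w : len G w₄ ≡ p + len G w + (N ∸ q)
      len-through-w = trans len₄ (cong₂ _+_ (trans len₃ (cong (_+ len G w) len₁)) len₂)

    record Placed (P : List V) (a : ℕ) : Set where
      field
        fits    : a + j ≤ N
        inside  : ∀ {y} → y ∈ P → ∃[ i ] (i ≤ j × y ≡ r (a + i))
        covers  : ∀ {i} → i ≤ j → r (a + i) ∈ P
        edges   : ∀ {i} → i < j → HasEdge G (r (a + i)) (r (suc (a + i))) P

    placed-nth : ∀ P a → a + j ≤ N → length P ≡ suc j →
      (∀ {i} → i < suc j → r (a + i) ≡ nth x₀ P i) → Placed P a
    placed-nth P a fits lenP agree = record
      { fits   = fits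
      ; inside = λ y∈P → inside (∈⇒nth x₀ y∈P)
      ; covers = λ i≤j → subst (_∈ P) (sym (agree (s≤s i≤j))) (nth-∈ x₀ P (in-range (s≤s i≤j)))
      ; edges  = λ {i} i<j → inj₁ (subst₂ (λ u v → Consec G u v P)
                    (sym (agree (m≤n⇒m≤1+n i<j)))
                    (trans (sym (agree (s≤s i<j))) (cong r (+-suc a i)))
                    (nth-consec x₀ P (in-range (s≤s i<j))))
      }
      where
      in-range : ∀ {i} → i < suc j → i < length P
      in-range = subst (_ <_) (sym lenP)
      inside : ∀ {y} → ∃[ i ] (i < length P × y ≡ nth x₀ P i) → ∃[ i ] (i ≤ j × y ≡ r (a + i))
      inside (i , lt , eq) = i , s≤s⁻¹ (subst (i <_) lenP lt) , trans eq (sym (agree (subst (i <_) lenP lt)))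

    placed-reverse⁻ : ∀ {P a} → Placed (reverse P) a → Placed P a
    placed-reverse⁻ {P} p = record
      { fits   = fits
      ; inside = inside ∘ reverse⁺
      ; covers = reverse⁻ ∘ covers
      ; edges  = hasEdge-reverse⁻ P ∘ edges
      }
      where open Placed p

    placed-++ : ∀ P as bs → R ≡ as ++ P ++ bs → length P ≡ suc j → Placed P (length as)
    placed-++ P as bs R≡ lenP = placed-nth P (length as) fits lenP agree
      where
      fits : length as + j ≤ N
      fits = s≤s⁻¹ (begin
        suc (length as + j)                 ≡⟨ +-suc (length as) j ⟨
        length as + suc j                   ≡⟨ cong (length as +_) lenP ⟨
        length as + length P                ≤⟨ +-monoʳ-≤ (length as) (m≤m+n (length P) (length bs)) ⟩
        length as + (length P + length bs)  ≡⟨ cong (length as +_) (length-++ P) ⟨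
        length as + length (P ++ bs)        ≡⟨ length-++ as ⟨
        length (as ++ P ++ bs)              ≡⟨ cong length R≡ ⟨
        suc N                               ∎)
        where open ≤-Reasoning
      agree : ∀ {i} → i < suc j → r (length as + i) ≡ nth x₀ P i
      agree {i} lt = trans (cong (λ L → nth x₀ L (length as + i)) R≡)
        (trans (nth-++ʳ x₀ as (P ++ bs) i) (nth-++ˡ x₀ P bs (subst (i <_) (sym lenP) lt)))

    liesOn⇒placed : ∀ {P} → IsWalk G P → len G P ≡ j → LiesOn G P R → ∃[ a ] Placed P a
    liesOn⇒placed {P} walk len≡j = placement
      where
      lenP : length P ≡ suc j
      lenP = trans (length≡suc-len P walk) (cong suc len≡j)
      placement : LiesOn G P R → ∃[ a ] Placed P a
      placement (inj₁ (as , bs , R≡)) = length as , placed-++ P as bs R≡ lenP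
      placement (inj₂ (as , bs , R≡)) =
        length as , placed-reverse⁻ (placed-++ (reverse P) as bs R≡ (trans (length-reverse P) lenP))

    -- Otherwise the first edge of Q would be one of the edges of P.
    edgeDisjoint⇒apart : ∀ {P Q a b} → 1 ≤ j → Placed P a → Placed Q b →
      EdgeDisjoint G P Q → a ≤ b → a + j ≤ b
    edgeDisjoint⇒apart {P} {Q} {a} {b} j≥1 p q disjoint a≤b with a + j ≤? b
    ... | yes a+j≤b = a+j≤b
    ... | no a+j≰b = ⊥-elim (disjoint (r b) (r (suc b)) shared-in-P shared-in-Q)
      where
      a+[b∸a]≡b : a + (b ∸ a) ≡ b
      a+[b∸a]≡b = m+[n∸m]≡n a≤b
      b∸a<j : b ∸ a < j
      b∸a<j = +-cancelˡ-< a (b ∸ a) j (subst (_< a + j) (sym a+[b∸a]≡b) (≰⇒> a+j≰b))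
      shared-in-P : HasEdge G (r b) (r (suc b)) P
      shared-in-P = subst (λ t → HasEdge G (r t) (r (suc t)) P) a+[b∸a]≡b (Placed.edges p b∸a<j)
      shared-in-Q : HasEdge G (r b) (r (suc b)) Q
      shared-in-Q = subst (λ t → HasEdge G (r t) (r (suc t)) Q) (+-identityʳ b) (Placed.edges q j≥1)

    placed⇒setDist : ∀ {P Q a b} → Placed P a → Placed Q b → a + j ≤ b → SetDist G P Q (b ∸ (a + j))
    placed⇒setDist {P} {Q} {a} {b} p q a+j≤b = attained , lower-bound
      where
      gap : ℕ
      gap = b ∸ (a + j)
      gap+a+j≡b : gap + (a + j) ≡ b
      gap+a+j≡b = m∸n+n≡m a+j≤b
      between : List V
      between = segment (λ i → r (i + (a + j))) gap
      between-walk : WalkFromTo G (r (a + j)) (r (gap + (a + j))) between × len G between ≡ gap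
      between-walk = stretch (a + j) gap
        (≤-trans (≤-reflexive gap+a+j≡b) (≤-trans (m≤m+n b j) (Placed.fits q)))
      attained : ∃[ x ] ∃[ y ] ∃[ w ] (x ∈ P × y ∈ Q × WalkFromTo G x y w × len G w ≡ gap)
      attained = r (a + j) , r b , between ,
        Placed.covers p ≤-refl ,
        subst (λ t → r t ∈ Q) (+-identityʳ b) (Placed.covers q z≤n) ,
        subst (λ t → WalkFromTo G (r (a + j)) (r t) between) gap+a+j≡b (proj₁ between-walk) ,
        proj₂ between-walk
      lower-bound : ∀ y z w → y ∈ P → z ∈ Q → WalkFromTo G y z w → gap ≤ len G w
      lower-bound y z w y∈P z∈Q W with Placed.inside p y∈P | Placed.inside q z∈Q
      ... | i , i≤j , refl | i' , i'≤j , refl =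
        ≤-trans (∸-mono (m≤m+n b i') (+-monoʳ-≤ a i≤j))
          (walk-length-on-geodesic (≤-trans (+-monoʳ-≤ a i≤j) (≤-trans a+j≤b (m≤m+n b i')))
            (≤-trans (+-monoʳ-≤ b i'≤j) (Placed.fits q)) W)

    placed⇒separated : ∀ {P Q a b ℓ} → 1 ≤ j → Placed P a → Placed Q b → EdgeDisjoint G P Q →
      (∀ d → SetDist G P Q d → ℓ ≤ d) → a ≤ b → a + (ℓ + j) ≤ b
    placed⇒separated {a = a} {b} {ℓ} j≥1 p q disjoint minimal a≤b = begin
      a + (ℓ + j)              ≡⟨ cong (a +_) (+-comm ℓ j) ⟩
      a + (j + ℓ)              ≡⟨ +-assoc a j ℓ ⟨
      a + j + ℓ                ≤⟨ +-monoʳ-≤ (a + j) (minimal _ (placed⇒setDist p q a+j≤b)) ⟩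
      a + j + (b ∸ (a + j))    ≡⟨ m+[n∸m]≡n a+j≤b ⟩
      b                        ∎
      where
      open ≤-Reasoning
      a+j≤b : a + j ≤ b
      a+j≤b = edgeDisjoint⇒apart j≥1 p q disjoint a≤b

proposition2p2 : (G : Graph) (j : ℕ) → 1 ≤ j →
    (S : List (Graph.V G) → Set) →
    (∀ P → S P → IsGeodesic G P × len G P ≡ j) →
    (∀ P Q → S P → S Q → ¬ P ≡ Q → EdgeDisjoint G P Q) →
    (ℓ : ℕ) → IsMinSetDist G S ℓ →
    (k : ℕ) → 2 ≤ k →
    (∀ P Q d → S P → S Q → ¬ P ≡ Q → OnCommonGeodesic G P Q →
      SetDist G P Q d → d < ℓ * (k ∸ 1) + j * (k ∸ 2)) →
    ∀ (R : List (Graph.V G)) (Ps : Fin k → List (Graph.V G)) →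
    IsGeodesic G R → Injective _≡_ _≡_ Ps →
    (∀ i → S (Ps i)) → (∀ i → LiesOn G (Ps i) R) → ⊥
proposition2p2 _ _ _ _ _ _ _ _ _ _ _ [] _ ((() , _) , _)
proposition2p2 G j j≥1 _ geodesic disjoint ℓ (_ , minimal) (suc (suc m)) (s≤s (s≤s z≤n)) close
               (x₀ ∷ R') Ps geoR injective inS lies =
  <⇒≱ (close _ _ _ (inS i) (inS i') Ps-distinct (x₀ ∷ R' , geoR , lies i , lies i')
                   (placed⇒setDist (placed i) (placed i') a+j≤b))
      (spread⇒gap (start i) (start i') j ℓ m spread)
  where
  open OnGeodesic G x₀ R' geoR j
  position : ∀ i → ∃[ a ] Placed (Ps i) a
  position i with geodesic (Ps i) (inS i)
  ... | ((walk , _) , _) , len≡j = liesOn⇒placed walk len≡j (lies i)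
  start : Fin (suc (suc m)) → ℕ
  start i = proj₁ (position i)
  placed : ∀ i → Placed (Ps i) (start i)
  placed i = proj₂ (position i)
  separated : Separated (ℓ + j) start
  separated {i} {i'} i≢i' = placed⇒separated j≥1 (placed i) (placed i')
    (disjoint _ _ (inS i) (inS i') (i≢i' ∘ injective))
    (λ d → minimal _ _ d (inS i) (inS i') (i≢i' ∘ injective))
  extremes : ∃[ i ] ∃[ i' ] (i ≢ i' × start i + suc m * (ℓ + j) ≤ start i')
  extremes = separated⇒spread-≢ m start separated
  i i' : Fin (suc (suc m))
  i = proj₁ extremes
  i' = proj₁ (proj₂ extremes)
  Ps-distinct : Ps i ≢ Ps i'
  Ps-distinct = proj₁ (proj₂ (proj₂ extremes)) ∘ injective
  spread : start i + suc m * (ℓ + j) ≤ start i'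
  spread = proj₂ (proj₂ (proj₂ extremes))
  a+j≤b : start i + j ≤ start i'
  a+j≤b = ≤-trans (+-monoʳ-≤ (start i) (≤-trans (m≤n+m j ℓ) (m≤m+n (ℓ + j) _))) spread
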